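{- In quasi-set theory $\mathcal{Q}$: for every $x$, any two strong singletons of $x$ are indistinguishable; that is, if $x'$ and $x''$ are qsets with $x'\subseteq[x]$, $x''\subseteq[x]$, $qc(x')=_E1$ and $qc(x'')=_E1$, then $x'\equiv x''$.
   Context: Quasi-set theory $\mathcal{Q}$ is a first-order theory in classical logic with no primitive equality symbol. Primitive symbols: unary predicates $m$ ("$x$ is an $m$-atom"), $M$ ("$x$ is an $M$-atom"), $Z$ ("$x$ is a set"); binary predicates $\equiv$ (indistinguishability) and $\in$; a unary function symbol $qc$ (quasi-cardinal). Abbreviations: $Q(x):=\neg(m(x)\vee M(x))$ ("$x$ is a qset"); $D(x):=M(x)\vee Z(x)$; $E(x):=Q(x)\wedge\forall y(y\in x\Rightarrow Q(y))$; $x=_E y:=(Q(x)\wedge Q(y)\wedge\forall z(z\in x\Leftrightarrow z\in y))\vee(M(x)\wedge M(y)\wedge\forall z(Q(z)\Rightarrow(x\in z\Leftrightarrow y\in z)))$ (extensional identity), $x\neq_E y:=\neg(x=_E y)$; $x\subseteq y:=\forall z(z\in x\Rightarrow z\in y)$; $x\subset y:=x\subseteq y\wedge x\neq_E y$; $\forall_Q,\exists_Q,\forall_D$ are quantifiers relativized to $Q$, $D$. Axioms of $\mathcal{Q}$: (Q1)–(Q3) $\equiv$ is reflexive, symmetric and transitive. (Q4) $\forall x\forall y(x=_E y\Rightarrow(A(x,x)\Rightarrow A(x,y)))$ for every formula $A$, with $A(x,y)$ obtained by replacing some free occurrences of $x$ by $y$, $y$ free for $x$. (Q5) $\forall x\,\neg(m(x)\wedge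 M(x))$. (Q6) $\forall x\forall y(x\in y\Rightarrow Q(y))$. (Q7) $\forall x(Z(x)\Rightarrow Q(x))$. (Q8) $\forall_Q x(\forall y(y\in x\Rightarrow D(y))\Leftrightarrow Z(x))$. (Q9) $\forall x\forall y(m(x)\wedge x\equiv y\Rightarrow m(y))$, $\forall x\forall y(x=_E y\wedge M(x)\Rightarrow M(y))$, $\forall x\forall y(x=_E y\wedge Z(x)\Rightarrow Z(y))$. (Q10) $\exists_Q x\forall y\,\neg(y\in x)$; such a qset is written $\emptyset$. (Q11) $\forall_D x\forall_D y(x\equiv y\Rightarrow x=_E y)$. (Q12) $\forall x\forall y\exists_Q z\forall t(t\in z\Leftrightarrow t\equiv x\vee t\equiv y)$; this qset is written $[x,y]$, and $[x]:=[x,x]$. (Q13) Separation: for each formula $A(t)$ without $y$ free, $\forall_Q x\exists_Q y\forall t(t\in y\Leftrightarrow t\in x\wedge A(t))$; written $[t\in x:A(t)]$. (Q14) $\forall_Q x(E(x)\Rightarrow\exists_Q y\forall z(z\in y\Leftrightarrow\exists t(z\in t\wedge t\in x)))$; written $\bigcup_{t\in x}t$. For qsets $x,y$, $x\cup y$, $x\cap y$, $x-y$ denote the qsets whose elements are exactly the objects in $x$ or in $y$, in both, in $x$ but not in $y$, respectively. (Q15) $\forall_Q x\exists_Q y\forall t(t\in y\Leftrightarrow t\subseteq x)$; written $\mathcal{P}(x)$. Also $\langle x,y\rangle:=[[x],[x,y]]$. (Q16) $\exists_Q x(\emptyset\in x\wedge\forall y(y\in x\wedge Q(y)\Rightarrow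 y\cup[y]\in x))$. (Q17) $\forall_Q x(E(x)\wedge x\neq_E\emptyset\Rightarrow\exists_Q y(y\in x\wedge y\cap x=_E\emptyset))$. The objects satisfying $D$ (with $\in$ and $=_E$) form a copy of ZFU set theory inside $\mathcal{Q}$; in it cardinals, natural numbers ($0,1,\dots$), cardinal arithmetic ($+,\le,<,2^\kappa$) and the cardinal $card(x)$ of a set are defined as usual; $Fin(x)$ means $qc(x)$ is a natural number. (Q18) $\forall x(\neg Q(x)\Rightarrow qc(x)=_E 0)$. (Q19) for every qset $x$, $qc(x)$ is a cardinal, and if $Z(x)$ then $qc(x)=_E card(x)$. (Q20) $\forall_Q x(x\neq_E\emptyset\Rightarrow qc(x)\neq_E 0)$. (Q21) for every qset $x$ and cardinal $\beta\le qc(x)$ there is a qset $y\subseteq x$ with $qc(y)=_E\beta$. (Q22) for qsets $y\subseteq x$, $qc(y)\le qc(x)$. (Q23) for qsets, $Fin(x)\wedge x\subset y\Rightarrow qc(x)<qc(y)$. (Q24) for qsets $x,y$ with no common element, $qc(x\cup y)=_E qc(x)+qc(y)$. (Q25) $\forall_Q x(qc(\mathcal{P}(x))=_E 2^{qc(x)})$. For nonempty qsets: $Sim(x,y):=\forall z\forall t(z\in x\wedge t\in y\Rightarrow z\equiv t)$, $QSim(x,y):=Sim(x,y)\wedge qc(x)=_E qc(y)$; $x/{\equiv}$ denotes the qset of the classes $[t\in x: t\equiv s]$ for $s\in x$. (Q26) Weak extensionality: $\forall_Q x\forall_Q y\big((\forall z(z\in x/{\equiv}\Rightarrow\exists t(t\in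 y/{\equiv}\wedge QSim(z,t)))\wedge\forall t(t\in y/{\equiv}\Rightarrow\exists z(z\in x/{\equiv}\wedge QSim(t,z))))\Rightarrow x\equiv y\big)$. (Q27) Replacement: for each formula $A(x,y)$, if $\forall x\exists y A(x,y)\wedge\forall x\forall x'\forall y\forall y'(A(x,y)\wedge A(x',y')\wedge x\equiv x'\Rightarrow y\equiv y')$, then $\forall_Q u\exists_Q v\forall z(z\in v\Rightarrow\exists w(w\in u\wedge A(w,z)))$. (Q28) Choice: $\forall_Q x\big(E(x)\wedge\forall y\forall z(y\in x\wedge z\in x\Rightarrow y\cap z=_E\emptyset\wedge y\neq_E\emptyset)\Rightarrow\exists_Q u\forall y\forall v(y\in x\wedge v\in y\Rightarrow\exists_Q w(w\subseteq[v]\wedge qc(w)=_E1\wedge w\cap y\equiv w\cap u))\big)$. A strong singleton of $x$ is a qset $x'$ with $x'\subseteq[x]$ and $qc(x')=_E 1$. -}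

module Defs where

open import Data.Product using (Σ; _×_; _,_)
open import Data.Sum using (_⊎_)
open import Data.Empty using (⊥)
open import Relation.Nullary using (¬_; Dec)

_⇔_ : Set → Set → Set
A ⇔ B = (A → B) × (B → A)
infix 2 _⇔_

-- The signature of quasi-set theory 𝒬 (no primitive equality).
record Sig : Set₁ where
  infix 4 _≣_ _∈_
  field
    U   : Set
    m   : U → Set
    M   : U → Set
    Z   : U → Set
    _≣_ : U → U → Set
    _∈_ : U → U → Set
    qc  : U → U

module Notions (S : Sig) where
  open Sig S

  Q : U → Set
  Q x = ¬ (m x ⊎ M x)

  D : U → Set
  D x = M x ⊎ Z x

  E : U → Set
  E x = Q x × (∀ y → y ∈ x → Q y)

  infix 4 _=E_ _⊆_
  _=E_ : U → U → Set
  x =E y = (Q x × Q y × (∀ z → z ∈ x ⇔ z ∈ y))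
         ⊎ (M x × M y × (∀ z → Q z → (x ∈ z ⇔ y ∈ z)))

  _⊆_ : U → U → Set
  x ⊆ y = ∀ z → z ∈ x → z ∈ y

  Empty : U → Set
  Empty x = ∀ y → ¬ (y ∈ x)

  -- "c =_E 0", where 0 is the empty set ∅ of the ZFU-copy
  -- (unfolding of =_E against an element-less qset)
  IsZero : U → Set
  IsZero c = Q c × Empty c

  -- "c =_E 1", where 1 = {0} in the ZFU-copy: the elements of 1 are
  -- exactly the objects =_E 0
  IsOne : U → Set
  IsOne c = Q c × (∀ z → z ∈ c ⇔ IsZero z)

  Sim : U → U → Set
  Sim x y = ∀ z t → z ∈ x → t ∈ y → z ≣ t

  QSim : U → U → Set
  QSim x y = Sim x y × qc x =E qc y

  -- "z ∈ x/≡": z is (=_E) a class [t ∈ x : t ≡ s] for some s ∈ x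
  IsClass : U → U → Set
  IsClass x z = Q z × Σ U (λ s → s ∈ x × (∀ t → t ∈ z ⇔ (t ∈ x × t ≣ s)))

  -- x' ⊆ [x], where [x] is the qset of Q12 whose elements are exactly the t ≡ x
  SubSingletonOf : U → U → Set
  SubSingletonOf x' x = ∀ t → t ∈ x' → t ≣ x

  StrongSingleton : U → U → Set
  StrongSingleton x x' = Q x' × SubSingletonOf x' x × IsOne (qc x')

-- A (classical) structure satisfying those axioms of 𝒬 (or theorems of 𝒬)
-- that are expressible without the full internal ZFU cardinal arithmetic.
record IsQModel (S : Sig) : Set₁ where
  open Sig S
  open Notions S
  field
    lem : (P : Set) → Dec P
    ≣-refl  : ∀ x → x ≣ x
    ≣-sym   : ∀ x y → x ≣ y → y ≣ x
    ≣-trans : ∀ x y z → x ≣ y → y ≣ z → x ≣ z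
    -- Q4, for atomic formulas (implies all instances of the schema)
    Q4-m    : ∀ x y → x =E y → m x → m y
    Q4-M    : ∀ x y → x =E y → M x → M y
    Q4-Z    : ∀ x y → x =E y → Z x → Z y
    Q4-∈ˡ   : ∀ x y z → x =E y → x ∈ z → y ∈ z
    Q4-∈ʳ   : ∀ x y z → x =E y → z ∈ x → z ∈ y
    Q4-≣ˡ   : ∀ x y z → x =E y → x ≣ z → y ≣ z
    Q4-≣ʳ   : ∀ x y z → x =E y → z ≣ x → z ≣ y
    Q4-qc   : ∀ x y → x =E y → qc x =E qc y
    Q5  : ∀ x → ¬ (m x × M x)
    Q6  : ∀ x y → x ∈ y → Q y
    Q7  : ∀ x → Z x → Q x
    Q8  : ∀ x → Q x → ((∀ y → y ∈ x → D y) ⇔ Z x)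
    Q9m : ∀ x y → m x → x ≣ y → m y
    Q9M : ∀ x y → x =E y → M x → M y
    Q9Z : ∀ x y → x =E y → Z x → Z y
    Q10 : Σ U (λ x → Q x × Empty x)
    Q11 : ∀ x y → D x → D y → x ≣ y → x =E y
    Q12 : ∀ x y → Σ U (λ z → Q z × (∀ t → t ∈ z ⇔ (t ≣ x ⊎ t ≣ y)))
    Q14 : ∀ x → Q x → E x →
          Σ U (λ y → Q y × (∀ z → z ∈ y ⇔ Σ U (λ t → z ∈ t × t ∈ x)))
    Q15 : ∀ x → Q x → Σ U (λ y → Q y × (∀ t → t ∈ y ⇔ t ⊆ x))
    Q17 : ∀ x → E x → ¬ Empty x →
          Σ U (λ y → Q y × y ∈ x × (∀ z → ¬ (z ∈ y × z ∈ x)))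
    Q18 : ∀ x → ¬ Q x → IsZero (qc x)
    -- instance of Q19 for the empty set (card(∅) = 0 in ZFU)
    Q19-∅ : ∀ x → Z x → Empty x → IsZero (qc x)
    Q20 : ∀ x → Q x → ¬ Empty x → ¬ IsZero (qc x)
    Q26 : ∀ x y → Q x → Q y →
          (∀ z → IsClass x z → Σ U (λ t → IsClass y t × QSim z t)) →
          (∀ t → IsClass y t → Σ U (λ z → IsClass x z × QSim t z)) →
          x ≣ y

record QModel : Set₁ where
  field
    sig  : Sig
    isQ  : IsQModel sig
  open Sig sig public
  open Notions sig public
  open IsQModel isQ public

-- Apply weak extensionality (Q26). A strong singleton x' of x is inhabited
-- (an empty qset is a set, whose quasi-cardinal is 0, not 1), and all its
-- elements are indistinguishable from x; hence x'/≡ has the single class x'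
-- itself. So the classes of x' and x'' are similar, and their quasi-cardinals
-- are qc x' =E 1 =E qc x''.
module Submission where

open import Defs
open import Data.Product using (Σ; _×_; _,_; proj₁; proj₂)
open import Data.Sum using (_⊎_; inj₁; inj₂)
open import Data.Empty using (⊥-elim)
open import Relation.Nullary using (¬_; yes; no)

module QsetFacts (𝓜 : QModel) where
  open QModel 𝓜

  =E-qsets : ∀ {a b} → Q a ⊎ Q b → a =E b → Q a × Q b × (∀ w → w ∈ a ⇔ w ∈ b)
  =E-qsets _         (inj₁ ext)          = ext
  =E-qsets (inj₁ qa) (inj₂ (ma , _ , _)) = ⊥-elim (qa (inj₂ ma))
  =E-qsets (inj₂ qb) (inj₂ (_ , mb , _)) = ⊥-elim (qb (inj₂ mb))

  =E-trans : ∀ {a b c} → Q b → a =E b → b =E c → a =E c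
  =E-trans qb ab bc with =E-qsets (inj₂ qb) ab | =E-qsets (inj₁ qb) bc
  ... | qa , _ , f | _ , qc' , g =
    inj₁ (qa , qc' , λ w → (λ h → proj₁ (g w) (proj₁ (f w) h)) ,
                           (λ h → proj₂ (f w) (proj₂ (g w) h)))

  IsOne-unique : ∀ {a b} → IsOne a → IsOne b → a =E b
  IsOne-unique (qa , fa) (qb , fb) =
    inj₁ (qa , qb , λ w → (λ h → proj₂ (fb w) (proj₁ (fa w) h)) ,
                          (λ h → proj₂ (fa w) (proj₁ (fb w) h)))

  IsOne⇒¬IsZero : ∀ {c} → IsOne c → ¬ IsZero c
  IsOne⇒¬IsZero (_ , f) (_ , empty) with Q10
  ... | o , zero = empty o (proj₂ (f o) zero)

  -- An empty qset is a set by Q8, so its quasi-cardinal is 0 by Q19.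
  qc≢0⇒inhabited : ∀ {b} → Q b → ¬ IsZero (qc b) → Σ U (_∈ b)
  qc≢0⇒inhabited {b} qb qc≢0 with lem (Σ U (_∈ b))
  ... | yes inhabited = inhabited
  ... | no uninhabited = ⊥-elim (qc≢0 (Q19-∅ b isSet empty))
    where
      empty : Empty b
      empty s s∈b = uninhabited (s , s∈b)
      isSet : Z b
      isSet = proj₁ (Q8 b qb) (λ y y∈b → ⊥-elim (empty y y∈b))

  SubSingletonOf⇒Sim : ∀ {a b x} → SubSingletonOf a x → SubSingletonOf b x → Sim a b
  SubSingletonOf⇒Sim {x = x} subA subB u v u∈a v∈b =
    ≣-trans u x v (subA u u∈a) (≣-sym v x (subB v v∈b))

  IsClass⇒⊆ : ∀ {a z} → IsClass a z → z ⊆ a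
  IsClass⇒⊆ (_ , _ , _ , f) w w∈z = proj₁ (proj₁ (f w) w∈z)

  Sim-self⇒IsClass-self : ∀ {a s} → Q a → Sim a a → s ∈ a → IsClass a a
  Sim-self⇒IsClass-self {s = s} qa selfSim s∈a =
    qa , s , s∈a , λ t → (λ t∈a → t∈a , selfSim t s t∈a s∈a) , proj₁

  Sim-self-IsClass⇒=E : ∀ {a z} → Q a → Sim a a → IsClass a z → z =E a
  Sim-self-IsClass⇒=E qa selfSim z-class@(qz , s , s∈a , f) =
    inj₁ (qz , qa , λ w → IsClass⇒⊆ z-class w ,
                          (λ w∈a → proj₂ (f w) (w∈a , selfSim w s w∈a s∈a)))

  StrongSingleton-classes-QSim :
    ∀ {x a b} → StrongSingleton x a → StrongSingleton x b →
    ∀ z → IsClass a z → Σ U (λ t → IsClass b t × QSim z t)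
  StrongSingleton-classes-QSim {a = a} {b} (qa , subA , oneA) (qb , subB , oneB) z z-class =
    b , Sim-self⇒IsClass-self qb (SubSingletonOf⇒Sim subB subB) (proj₂ inhabitedB) ,
    similar , sameQc
    where
      inhabitedB : Σ U (_∈ b)
      inhabitedB = qc≢0⇒inhabited qb (IsOne⇒¬IsZero oneB)
      similar : Sim z b
      similar = SubSingletonOf⇒Sim (λ t t∈z → subA t (IsClass⇒⊆ z-class t t∈z)) subB
      z=a : z =E a
      z=a = Sim-self-IsClass⇒=E qa (SubSingletonOf⇒Sim subA subA) z-class
      sameQc : qc z =E qc b
      sameQc = =E-trans (proj₁ oneA) (Q4-qc z a z=a) (IsOne-unique oneA oneB)

theorem8 : (𝓜 : QModel) → let open QModel 𝓜 in
    ∀ x x' x'' → StrongSingleton x x' → StrongSingleton x x'' → x' ≣ x''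
theorem8 𝓜 x x' x'' s' s'' =
  Q26 x' x'' (proj₁ s') (proj₁ s'')
      (StrongSingleton-classes-QSim s' s'')
      (StrongSingleton-classes-QSim s'' s')
  where open QModel 𝓜
        open QsetFacts 𝓜
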